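{- The extended shuffle product is graded with respect to depth: if $D_n\subseteq\mathcal H_{\mathbb Z}$ denotes the span of basis elements of depth $n$ (with $D_0=\mathbb Q\mathbf 1$), then $D_n\sqcup\!\sqcup D_m\subseteq D_{n+m}$ for all $n,m\ge 0$.
   Context: Let $\mathcal H_{\mathbb Z}$ be the $\mathbb Q$-vector space with basis $\mathbf 1$ together with the formal symbols $[s_1,\dots,s_k]$ for $k\ge1$ and $(s_1,\dots,s_k)\in\mathbb Z^k$. The depth of $[s_1,\dots,s_k]$ is $k$, and the depth of $\mathbf 1$ is $0$. Define linear maps on basis elements of positive depth by $I([s_1,s_2,\dots,s_k])=[s_1+1,s_2,\dots,s_k]$ and $J([s_1,s_2,\dots,s_k])=[s_1-1,s_2,\dots,s_k]$, and set $J(\mathbf 1)=0$. Notation: for a positive-depth basis element, write $[s_1,\dots,s_k]=[s_1,\vec s\,']$, where $[\vec s\,']=[s_2,\dots,s_k]$, or $\mathbf 1$ if $k=1$. For $a\in\mathbb Z$ and $X=\sum c_{\vec v}[\vec v]$, put $[a,X]:=\sum c_{\vec v}[a,\vec v]$, with $[a,\mathbf 1]:=[a]$. The extended shuffle product $\sqcup\!\sqcup$ is the bilinear product with two-sided unit $\mathbf 1$, defined on positive-depth basis elements by the following recursions: <ul> <li>(i) if $s_1=0$: $[0,\vec s\,']\sqcup\!\sqcup[t_1,\vec t\,']=[0,[\vec s\,']\sqcup\!\sqcup[t_1,\vec t\,']]$;</li> <li>(ii) if $s_1>0$ and $t_1=0$: $[s_1,\vec s\,']\sqcup\!\sqcup[0,\vec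 t\,']=[0,[s_1,\vec s\,']\sqcup\!\sqcup[\vec t\,']]$;</li> <li>(iii) if $s_1,t_1>0$: $[s_1,\vec s\,']\sqcup\!\sqcup[t_1,\vec t\,']=I([s_1,\vec s\,']\sqcup\!\sqcup[t_1-1,\vec t\,'])+I([s_1-1,\vec s\,']\sqcup\!\sqcup[t_1,\vec t\,'])$;</li> <li>(iv) if $s_1>0$ and $t_1<0$: $[s_1,\vec s\,']\sqcup\!\sqcup[t_1,\vec t\,']=J([s_1,\vec s\,']\sqcup\!\sqcup[t_1+1,\vec t\,'])-[s_1-1,\vec s\,']\sqcup\!\sqcup[t_1+1,\vec t\,']$;</li> <li>(v) if $s_1<0$: $[s_1,\vec s\,']\sqcup\!\sqcup[t_1,\vec t\,']=J([s_1+1,\vec s\,']\sqcup\!\sqcup[t_1,\vec t\,'])-[s_1+1,\vec s\,']\sqcup\!\sqcup[t_1-1,\vec t\,']$.</li> </ul> The recursions are well founded: (i) and (ii) by induction on total depth, (iii) on $s_1+t_1$, (iv) on $|t_1|$, and (v) on $|s_1|$. -}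

module Defs where

open import Data.Nat using (ℕ; zero; suc)
open import Data.Integer using (ℤ; +_; -[1+_]) renaming (suc to sucℤ; pred to predℤ)
open import Data.Integer.Properties using () renaming (_≟_ to _≟ℤ_)
open import Data.Rational using (ℚ; 0ℚ; 1ℚ; -_; _+_; _*_)
open import Data.List using (List; []; _∷_; _++_; map; concatMap; length)
open import Data.List.Properties using (≡-dec)
open import Data.Product using (_×_; _,_)
open import Relation.Nullary using (yes; no)
open import Relation.Binary.PropositionalEquality using (_≡_; _≢_)

-- A word (s₁,…,s_k) ∈ ℤ^k; the empty word [] stands for the unit 𝟏 (depth 0).
Word : Set
Word = List ℤ

-- Elements of H_ℤ as finite formal ℚ-linear combinations of basis words.
H : Set
H = List (ℚ × Word)

coeff : H → Word → ℚ
coeff [] w = 0ℚ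
coeff ((c , w') ∷ X) w with ≡-dec _≟ℤ_ w' w
... | yes _ = c + coeff X w
... | no  _ = coeff X w

InD : ℕ → H → Set
InD n X = ∀ (w : Word) → length w ≢ n → coeff X w ≡ 0ℚ

-- I and J on basis words (I is only applied to positive depth; J(𝟏) = 0)
I : H → H
I [] = []
I ((c , []) ∷ X) = I X
I ((c , s ∷ w) ∷ X) = (c , sucℤ s ∷ w) ∷ I X

J : H → H
J [] = []
J ((c , []) ∷ X) = J X
J ((c , s ∷ w) ∷ X) = (c , predℤ s ∷ w) ∷ J X

neg : H → H
neg = map (λ { (c , w) → (- c , w) })

pre : ℤ → H → H
pre a = map (λ { (c , w) → (c , a ∷ w) })

-- F u v a b = [a,u] ⧢ [b,v]; caseI u v b = [u] ⧢ [b,v]; caseII u v a = [a,u] ⧢ [v]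
mutual
  caseI : Word → Word → ℤ → H
  caseI [] v b = (1ℚ , b ∷ v) ∷ []
  caseI (c ∷ u) v b = F u v c b

  caseII : Word → Word → ℤ → H
  caseII u [] a = (1ℚ , a ∷ u) ∷ []
  caseII u (d ∷ v) a = F u v a d

  F : Word → Word → ℤ → ℤ → H
  F u v (+ zero) b = pre (+ 0) (caseI u v b)
  F u v (+ suc m) (+ zero) = pre (+ 0) (caseII u v (+ suc m))
  F u v (+ suc m) (+ suc k) = I (F u v (+ suc m) (+ k)) ++ I (F u v (+ m) (+ suc k))
  F u v (+ suc m) -[1+ zero ] =
    J (pre (+ 0) (caseII u v (+ suc m))) ++ neg (F u v (+ m) (+ 0))
  F u v (+ suc m) -[1+ suc k ] =
    J (F u v (+ suc m) -[1+ k ]) ++ neg (F u v (+ m) -[1+ k ])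
  F u v -[1+ zero ] b =
    J (pre (+ 0) (caseI u v b)) ++ neg (pre (+ 0) (caseI u v (predℤ b)))
  F u v -[1+ suc m ] b =
    J (F u v -[1+ m ] b) ++ neg (F u v -[1+ m ] (predℤ b))

sh : Word → Word → H
sh [] v = (1ℚ , v) ∷ []
sh (a ∷ u) [] = (1ℚ , a ∷ u) ∷ []
sh (a ∷ u) (b ∷ v) = F u v a b

scale : ℚ → H → H
scale c = map (λ { (d , w) → (c * d , w) })

_⧢_ : H → H → H
X ⧢ Y = concatMap (λ { (c , u) → concatMap (λ { (d , v) → scale (c * d) (sh u v) }) Y }) X

{-# OPTIONS --safe #-}
-- Each recursion (i)–(v) prefixes a letter, changes the first letter (I, J),
-- negates or concatenates, so every term of [u] ⧢ [v] has depth |u| + |v|.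
-- By bilinearity the coefficient of w in X ⧢ Y is Σ X_u Y_v ([u] ⧢ [v])_w,
-- and when |w| ≠ n + m every summand has X_u = 0, Y_v = 0 or |u| + |v| ≠ |w|.
module Submission where

open import Defs
open import Algebra.Bundles using (CommutativeMonoid)
open import Data.Nat as ℕ using (ℕ; suc; _+_)
import Data.Nat.Properties as ℕ
open import Data.Integer using (+_; -[1+_])
open import Data.Integer.Properties using () renaming (_≟_ to _≟ℤ_)
open import Data.Rational as ℚ using (ℚ; 0ℚ)
import Data.Rational.Properties as ℚ
open import Data.List using ([]; _∷_; [_]; _++_; length)
open import Data.List.Properties using (≡-dec; ++-assoc; ++-identityʳ)
open import Data.List.Relation.Unary.All as All using (All; []; _∷_)
open import Data.List.Relation.Unary.All.Properties using (++⁺; map⁺)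
open import Data.Product using (_,_)
open import Data.Sum using (_⊎_; inj₁; inj₂; map₁)
open import Function using (_∘_; flip)
open import Relation.Nullary using (yes; no; contradiction)
open import Relation.Binary.PropositionalEquality
  using (_≡_; _≢_; refl; sym; trans; cong; cong₂; subst; module ≡-Reasoning)
open import Algebra.Properties.CommutativeSemigroup
  (CommutativeMonoid.commutativeSemigroup ℚ.+-0-commutativeMonoid) using (x∙yz≈y∙xz)

open ≡-Reasoning

Homogeneous : ℕ → H → Set
Homogeneous k = All (λ (_ , w) → length w ≡ k)

I-homogeneous : ∀ {k} X → Homogeneous k X → Homogeneous k (I X)
I-homogeneous []                  []      = []
I-homogeneous ((_ , [])    ∷ X) (_ ∷ h) = I-homogeneous X h
I-homogeneous ((_ , _ ∷ _) ∷ X) (p ∷ h) = p ∷ I-homogeneous X h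

J-homogeneous : ∀ {k} X → Homogeneous k X → Homogeneous k (J X)
J-homogeneous []                  []      = []
J-homogeneous ((_ , [])    ∷ X) (_ ∷ h) = J-homogeneous X h
J-homogeneous ((_ , _ ∷ _) ∷ X) (p ∷ h) = p ∷ J-homogeneous X h

neg-homogeneous : ∀ {k X} → Homogeneous k X → Homogeneous k (neg X)
neg-homogeneous = map⁺

pre-homogeneous : ∀ a {k X} → Homogeneous k X → Homogeneous (suc k) (pre a X)
pre-homogeneous a h = map⁺ (All.map (cong suc) h)

pre-homogeneous-+suc : ∀ a {m n X} → Homogeneous (m + n) X → Homogeneous (m + suc n) (pre a X)
pre-homogeneous-+suc a {m} {n} h =
  subst (flip Homogeneous _) (sym (ℕ.+-suc m n)) (pre-homogeneous a h)

mutual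
  caseI-homogeneous : ∀ u v b → Homogeneous (length u + suc (length v)) (caseI u v b)
  caseI-homogeneous []      v b = refl ∷ []
  caseI-homogeneous (c ∷ u) v b = F-homogeneous u v c b

  caseII-homogeneous : ∀ u v a → Homogeneous (suc (length u) + length v) (caseII u v a)
  caseII-homogeneous u []      a = sym (ℕ.+-identityʳ _) ∷ []
  caseII-homogeneous u (d ∷ v) a = F-homogeneous u v a d

  F-homogeneous : ∀ u v a b → Homogeneous (suc (length u) + suc (length v)) (F u v a b)
  F-homogeneous u v (+ 0) b = pre-homogeneous (+ 0) (caseI-homogeneous u v b)
  F-homogeneous u v (+ suc m) (+ 0) =
    pre-homogeneous-+suc (+ 0) {m = suc (length u)} (caseII-homogeneous u v (+ suc m))
  F-homogeneous u v (+ suc m) (+ suc k) =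
    ++⁺ (I-homogeneous _ (F-homogeneous u v (+ suc m) (+ k)))
        (I-homogeneous _ (F-homogeneous u v (+ m) (+ suc k)))
  F-homogeneous u v (+ suc m) -[1+ 0 ] =
    ++⁺ (J-homogeneous _
          (pre-homogeneous-+suc (+ 0) {m = suc (length u)} (caseII-homogeneous u v (+ suc m))))
        (neg-homogeneous (F-homogeneous u v (+ m) (+ 0)))
  F-homogeneous u v (+ suc m) -[1+ suc k ] =
    ++⁺ (J-homogeneous _ (F-homogeneous u v (+ suc m) -[1+ k ]))
        (neg-homogeneous (F-homogeneous u v (+ m) -[1+ k ]))
  F-homogeneous u v -[1+ 0 ] b =
    ++⁺ (J-homogeneous _ (pre-homogeneous (+ 0) (caseI-homogeneous u v b)))
        (neg-homogeneous (pre-homogeneous (+ 0) (caseI-homogeneous u v _)))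
  F-homogeneous u v -[1+ suc m ] b =
    ++⁺ (J-homogeneous _ (F-homogeneous u v -[1+ m ] b))
        (neg-homogeneous (F-homogeneous u v -[1+ m ] _))

sh-homogeneous : ∀ u v → Homogeneous (length u + length v) (sh u v)
sh-homogeneous []      v       = refl ∷ []
sh-homogeneous (a ∷ u) []      = sym (ℕ.+-identityʳ _) ∷ []
sh-homogeneous (a ∷ u) (b ∷ v) = F-homogeneous u v a b

homogeneous⇒InD : ∀ {k} X → Homogeneous k X → InD k X
homogeneous⇒InD []              []      w _   = refl
homogeneous⇒InD ((_ , w′) ∷ X) (p ∷ h) w |w|≢k with ≡-dec _≟ℤ_ w′ w
... | yes refl = contradiction p |w|≢k
... | no  _    = homogeneous⇒InD X h w |w|≢k

sh-InD : ∀ {n m} u v → length u ≡ n → length v ≡ m → InD (n + m) (sh u v)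
sh-InD u v refl refl = homogeneous⇒InD (sh u v) (sh-homogeneous u v)

coeff-++ : ∀ X Y w → coeff (X ++ Y) w ≡ coeff X w ℚ.+ coeff Y w
coeff-++ []              Y w = sym (ℚ.+-identityˡ _)
coeff-++ ((c , w′) ∷ X) Y w with ≡-dec _≟ℤ_ w′ w
... | yes _ = trans (cong (c ℚ.+_) (coeff-++ X Y w)) (sym (ℚ.+-assoc c _ _))
... | no  _ = coeff-++ X Y w

coeff-scale : ∀ c X w → coeff (scale c X) w ≡ c ℚ.* coeff X w
coeff-scale c []              w = sym (ℚ.*-zeroʳ c)
coeff-scale c ((d , w′) ∷ X) w with ≡-dec _≟ℤ_ w′ w
... | yes _ = trans (cong (c ℚ.* d ℚ.+_) (coeff-scale c X w)) (sym (ℚ.*-distribˡ-+ c d _))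
... | no  _ = coeff-scale c X w

pairing : H → (Word → ℚ) → ℚ
pairing []             K = 0ℚ
pairing ((c , u) ∷ X) K = c ℚ.* K u ℚ.+ pairing X K

coeff-singleton-⧢ : ∀ c u Y w →
  coeff ([ (c , u) ] ⧢ Y) w ≡ c ℚ.* pairing Y (λ v → coeff (sh u v) w)
coeff-singleton-⧢ c u []             w = sym (ℚ.*-zeroʳ c)
coeff-singleton-⧢ c u ((d , v) ∷ Y) w = begin
  coeff ([ (c , u) ] ⧢ ((d , v) ∷ Y)) w
    ≡⟨ cong (λ Z → coeff Z w) (++-assoc c·d·uv _ []) ⟩
  coeff (c·d·uv ++ ([ (c , u) ] ⧢ Y)) w
    ≡⟨ coeff-++ c·d·uv _ w ⟩
  coeff c·d·uv w ℚ.+ coeff ([ (c , u) ] ⧢ Y) w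
    ≡⟨ cong₂ ℚ._+_ (coeff-scale (c ℚ.* d) (sh u v) w) (coeff-singleton-⧢ c u Y w) ⟩
  c ℚ.* d ℚ.* coeff (sh u v) w ℚ.+ c ℚ.* pairing Y K
    ≡⟨ cong (ℚ._+ c ℚ.* pairing Y K) (ℚ.*-assoc c d _) ⟩
  c ℚ.* (d ℚ.* coeff (sh u v) w) ℚ.+ c ℚ.* pairing Y K
    ≡⟨ sym (ℚ.*-distribˡ-+ c _ _) ⟩
  c ℚ.* pairing ((d , v) ∷ Y) K ∎
  where
  c·d·uv = scale (c ℚ.* d) (sh u v)
  K = λ v → coeff (sh u v) w

∷-⧢ : ∀ c u X Y → ((c , u) ∷ X) ⧢ Y ≡ ([ (c , u) ] ⧢ Y) ++ (X ⧢ Y)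
∷-⧢ c u X Y = cong (_++ (X ⧢ Y)) (sym (++-identityʳ _))

coeff-⧢ : ∀ X Y w → coeff (X ⧢ Y) w ≡ pairing X (λ u → pairing Y (λ v → coeff (sh u v) w))
coeff-⧢ []             Y w = refl
coeff-⧢ ((c , u) ∷ X) Y w = begin
  coeff (((c , u) ∷ X) ⧢ Y) w
    ≡⟨ cong (λ Z → coeff Z w) (∷-⧢ c u X Y) ⟩
  coeff (([ (c , u) ] ⧢ Y) ++ (X ⧢ Y)) w
    ≡⟨ coeff-++ ([ (c , u) ] ⧢ Y) (X ⧢ Y) w ⟩
  coeff ([ (c , u) ] ⧢ Y) w ℚ.+ coeff (X ⧢ Y) w
    ≡⟨ cong₂ ℚ._+_ (coeff-singleton-⧢ c u Y w) (coeff-⧢ X Y w) ⟩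
  pairing ((c , u) ∷ X) (λ u → pairing Y (λ v → coeff (sh u v) w)) ∎

coeff-∷-≢ : ∀ c {u w} X → u ≢ w → coeff ((c , u) ∷ X) w ≡ coeff X w
coeff-∷-≢ c {u} {w} X u≢w with ≡-dec _≟ℤ_ u w
... | yes u≡w = contradiction u≡w u≢w
... | no  _   = refl

erase : Word → (Word → ℚ) → Word → ℚ
erase u K w with ≡-dec _≟ℤ_ w u
... | yes _ = 0ℚ
... | no  _ = K w

erase-self : ∀ u K → erase u K u ≡ 0ℚ
erase-self u K with ≡-dec _≟ℤ_ u u
... | yes _   = refl
... | no  u≢u = contradiction refl u≢u

pairing-erase : ∀ X K u → pairing X K ≡ coeff X u ℚ.* K u ℚ.+ pairing X (erase u K)
pairing-erase []             K u = sym (cong (ℚ._+ 0ℚ) (ℚ.*-zeroˡ (K u)))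
pairing-erase ((c , w) ∷ X) K u with ≡-dec _≟ℤ_ w u
... | yes refl = begin
  c ℚ.* K w ℚ.+ pairing X K
    ≡⟨ cong (c ℚ.* K w ℚ.+_) (pairing-erase X K w) ⟩
  c ℚ.* K w ℚ.+ (coeff X w ℚ.* K w ℚ.+ P)
    ≡⟨ sym (ℚ.+-assoc (c ℚ.* K w) (coeff X w ℚ.* K w) P) ⟩
  c ℚ.* K w ℚ.+ coeff X w ℚ.* K w ℚ.+ P
    ≡⟨ cong₂ ℚ._+_ (sym (ℚ.*-distribʳ-+ (K w) c _)) (sym (ℚ.+-identityˡ P)) ⟩
  (c ℚ.+ coeff X w) ℚ.* K w ℚ.+ (0ℚ ℚ.+ P)
    ≡⟨ cong (λ z → (c ℚ.+ coeff X w) ℚ.* K w ℚ.+ (z ℚ.+ P)) (sym (ℚ.*-zeroʳ c)) ⟩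
  (c ℚ.+ coeff X w) ℚ.* K w ℚ.+ (c ℚ.* 0ℚ ℚ.+ P) ∎
  where P = pairing X (erase w K)
... | no _ = begin
  c ℚ.* K w ℚ.+ pairing X K
    ≡⟨ cong (c ℚ.* K w ℚ.+_) (pairing-erase X K u) ⟩
  c ℚ.* K w ℚ.+ (coeff X u ℚ.* K u ℚ.+ pairing X (erase u K))
    ≡⟨ x∙yz≈y∙xz (c ℚ.* K w) (coeff X u ℚ.* K u) (pairing X (erase u K)) ⟩
  coeff X u ℚ.* K u ℚ.+ (c ℚ.* K w ℚ.+ pairing X (erase u K)) ∎

zero-product : ∀ x y → x ≡ 0ℚ ⊎ y ≡ 0ℚ → x ℚ.* y ≡ 0ℚ
zero-product _ y (inj₁ refl) = ℚ.*-zeroˡ y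
zero-product x _ (inj₂ refl) = ℚ.*-zeroʳ x

-- A word may recur in X with cancelling coefficients, so the hypothesis is on
-- coeff X; erasing K at u accounts for all occurrences of u at once.
pairing-vanishes : ∀ X K → (∀ u → coeff X u ≡ 0ℚ ⊎ K u ≡ 0ℚ) → pairing X K ≡ 0ℚ
pairing-vanishes []             K _ = refl
pairing-vanishes ((c , u) ∷ X) K h = begin
  pairing ((c , u) ∷ X) K
    ≡⟨ pairing-erase ((c , u) ∷ X) K u ⟩
  coeff ((c , u) ∷ X) u ℚ.* K u ℚ.+ (c ℚ.* erase u K u ℚ.+ pairing X (erase u K))
    ≡⟨ cong₂ ℚ._+_ (zero-product (coeff ((c , u) ∷ X) u) (K u) (h u))
                   (cong₂ ℚ._+_ (zero-product c (erase u K u) (inj₂ (erase-self u K)))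
                                (pairing-vanishes X (erase u K) h′)) ⟩
  0ℚ ℚ.+ (0ℚ ℚ.+ 0ℚ) ∎
  where
  h′ : ∀ w → coeff X w ≡ 0ℚ ⊎ erase u K w ≡ 0ℚ
  h′ w with ≡-dec _≟ℤ_ w u
  ... | yes _   = inj₂ refl
  ... | no  w≢u = map₁ (trans (sym (coeff-∷-≢ c X (w≢u ∘ sym)))) (h w)

pairing-InD-vanishes : ∀ {n} X K → InD n X → (∀ u → length u ≡ n → K u ≡ 0ℚ) → pairing X K ≡ 0ℚ
pairing-InD-vanishes {n} X K X∈Dn K≡0 = pairing-vanishes X K split
  where
  split : ∀ u → coeff X u ≡ 0ℚ ⊎ K u ≡ 0ℚ
  split u with length u ℕ.≟ n
  ... | yes |u|≡n = inj₂ (K≡0 u |u|≡n)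
  ... | no  |u|≢n = inj₁ (X∈Dn u |u|≢n)

corollary2p15 : (n m : ℕ) (X Y : H) → InD n X → InD m Y → InD (n + m) (X ⧢ Y)
corollary2p15 n m X Y X∈Dn Y∈Dm w |w|≢n+m = begin
  coeff (X ⧢ Y) w
    ≡⟨ coeff-⧢ X Y w ⟩
  pairing X (λ u → pairing Y (λ v → coeff (sh u v) w))
    ≡⟨ pairing-InD-vanishes X _ X∈Dn (λ u |u|≡n →
         pairing-InD-vanishes Y _ Y∈Dm (λ v |v|≡m →
           sh-InD u v |u|≡n |v|≡m w |w|≢n+m)) ⟩
  0ℚ ∎
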